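{- If $S$ is a spider of order $n$ with $k\ge 2$ legs, then $\mathrm{Mo}^{\top}(S)=(k-2)(n-1)$.
   Context: A spider with $k$ legs is a tree consisting of a central vertex $c$ together with $k$ vertex-disjoint paths (the legs), each joined to $c$ by a single edge from one of its endpoints. A pendent vertex is a vertex of degree $1$. For a graph $G$ and an edge $\{u,v\}\in E(G)$, let $\ell_G(u,v)$ be the number of pendent vertices of $G$ strictly closer to $u$ than to $v$. The terminal Mostar index is $\mathrm{Mo}^{\top}(G)=\sum_{\{u,v\}\in E(G)}|\ell_G(u,v)-\ell_G(v,u)|$. -}

module Defs where

open import Data.Nat.Base using (ℕ; zero; suc; _+_; _*_; _∸_; _≡ᵇ_; _<ᵇ_; ∣_-_∣)
open import Data.Nat.ListAction using (sum)
open import Data.Bool.ListAction using (any)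
open import Data.Bool.Base using (Bool; true; false; if_then_else_; _∧_; _∨_; not)
open import Data.List.Base using (List; []; _∷_; _++_; map; length; upTo)
open import Data.Product.Base using (_×_; _,_)

-- A finite (simple, undirected) graph: vertices 0 … order-1, and a list of
-- edges, each unordered edge {u,v} listed exactly once as a pair (u , v).
record Graph : Set where
  constructor mkGraph
  field
    order : ℕ
    edges : List (ℕ × ℕ)
open Graph public

vertices : Graph → List ℕ
vertices G = upTo (order G)

count : (ℕ → Bool) → List ℕ → ℕ
count p xs = sum (map (λ x → if p x then 1 else 0) xs)

adj : Graph → ℕ → ℕ → Bool
adj G u v = any (λ { (a , b) → ((a ≡ᵇ u) ∧ (b ≡ᵇ v)) ∨ ((a ≡ᵇ v) ∧ (b ≡ᵇ u)) }) (edges G)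

within : Graph → ℕ → ℕ → ℕ → Bool
within G zero    u v = u ≡ᵇ v
within G (suc d) u v = within G d u v ∨ any (λ w → within G d u w ∧ adj G w v) (vertices G)

-- least d (starting at d₀, at most fuel further steps) satisfying p
firstFrom : ℕ → ℕ → (ℕ → Bool) → ℕ
firstFrom zero     d p = d
firstFrom (suc f) d p = if p d then d else firstFrom f (suc d) p

-- shortest-path distance (for connected graphs, where it is ≤ order - 1)
dist : Graph → ℕ → ℕ → ℕ
dist G u v = firstFrom (order G) 0 (λ d → within G d u v)

degree : Graph → ℕ → ℕ
degree G v = count (adj G v) (vertices G)

pendent : Graph → ℕ → Bool
pendent G v = degree G v ≡ᵇ 1

ℓ : Graph → ℕ → ℕ → ℕ
ℓ G u v = count (λ w → pendent G w ∧ (dist G w u <ᵇ dist G w v)) (vertices G)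

MoT : Graph → ℕ
MoT G = sum (map (λ { (u , v) → ∣ ℓ G u v - ℓ G v u ∣ }) (edges G))

-- The spider with leg lengths L₁ … L_k (each Lᵢ ≥ 1) has the
-- centre 0 and leg i on consecutive vertices o, o+1, …, o+Lᵢ-1, where
-- vertex o (first vertex of the leg) is joined to the centre.

pathEdges : ℕ → ℕ → List (ℕ × ℕ)
pathEdges o zero    = []
pathEdges o (suc L) = (o , suc o) ∷ pathEdges (suc o) L

legEdges : ℕ → ℕ → List (ℕ × ℕ)
legEdges o zero    = []
legEdges o (suc L) = (0 , o) ∷ pathEdges o L

spiderEdges : ℕ → List ℕ → List (ℕ × ℕ)
spiderEdges o []       = []
spiderEdges o (L ∷ ls) = legEdges o L ++ spiderEdges (o + L) ls

spider : List ℕ → Graph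
spider legs = mkGraph (suc (sum legs)) (spiderEdges 1 legs)

-- Index the vertices of the spider by leg and depth.  The distance between two vertices is then
-- explicit (the difference of depths on a common leg, their sum through the centre otherwise),
-- and Defs.dist, a breadth-first search, agrees with it because this formula vanishes only on the
-- diagonal, changes by exactly one along every edge, and when positive drops along some edge.
-- The pendent vertices are the k leg ends.  For an edge joining a vertex of leg i to its child,
-- the end of leg i is the only pendent vertex closer to the child, and no vertex is equidistant
-- from the two ends of an edge; so each of the n - 1 edges contributes (k - 1) - 1 = k - 2.
module Submission where

open import Defs
open import Data.Bool.Base using (Bool; true; false; T; not; _∧_; if_then_else_)
open import Data.Bool.Properties using (T-≡; T-∧; T-∨)
open import Data.Empty using (⊥-elim)
open import Data.Fin.Base using (Fin; zero; suc)
import Data.Fin.Properties as Fin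
open import Data.List.Base using (List; []; _∷_; _++_; length; lookup; map; upTo; applyUpTo)
open import Data.List.Membership.Propositional using (_∈_; lose; find)
open import Data.List.Membership.Propositional.Properties
  using (∈-upTo⁺; ∈-upTo⁻; ∈-++⁻; ∈-++⁺ˡ; ∈-++⁺ʳ)
open import Data.List.Properties using (map-++; map-∘; map-applyUpTo; length-++)
open import Data.List.Relation.Unary.All using (All; []; _∷_) renaming (lookup to All-lookup)
open import Data.List.Relation.Unary.Any using (here; there)
open import Data.List.Relation.Unary.Any.Properties using (any⁺; any⁻)
open import Data.List.Relation.Unary.Unique.Propositional using (Unique; _∷_)
open import Data.List.Relation.Unary.Unique.Propositional.Properties using (upTo⁺)
open import Data.Nat.Base
  using ( ℕ; zero; suc; pred; _+_; _*_; _∸_; _≤_; _<_; _≤ᵇ_; _<ᵇ_; _≡ᵇ_; ∣_-_∣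
        ; z≤n; s≤s; s≤s⁻¹; z<s; s<s; >-nonZero)
open import Data.Nat.ListAction using (sum)
open import Data.Nat.ListAction.Properties using (sum-++)
open import Data.Nat.Properties
open import Data.Product.Base using (_×_; _,_; ∃-syntax; proj₁; proj₂)
open import Data.Sum.Base using (_⊎_; inj₁; inj₂)
import Data.Sum.Base as Sum
open import Data.Unit.Base using (⊤; tt)
open import Function.Base using (_∘_; id)
open import Function.Bundles using (_⇔_; mk⇔; Equivalence)
open import Relation.Binary.Definitions using (tri<; tri≈; tri>)
open import Relation.Binary.PropositionalEquality
  using (_≡_; _≢_; refl; sym; trans; cong; cong₂; subst; subst₂; module ≡-Reasoning)
open import Relation.Nullary using (¬_; Dec; yes; no; contradiction)

T-⇔⇒≡ : ∀ {a b : Bool} → (T a → T b) → (T b → T a) → a ≡ b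
T-⇔⇒≡ {false} {false} _ _ = refl
T-⇔⇒≡ {false} {true}  _ g = ⊥-elim (g _)
T-⇔⇒≡ {true}  {false} f _ = ⊥-elim (f _)
T-⇔⇒≡ {true}  {true}  _ _ = refl

<ᵇ-true : ∀ {m n} → m < n → (m <ᵇ n) ≡ true
<ᵇ-true m<n = Equivalence.to T-≡ (<⇒<ᵇ m<n)

<ᵇ-false : ∀ {m n} → ¬ m < n → (m <ᵇ n) ≡ false
<ᵇ-false {m} {n} m≮n with m <ᵇ n in eq
... | false = refl
... | true  = contradiction (<ᵇ⇒< m n (subst T (sym eq) tt)) m≮n

not-<ᵇ : ∀ {m n} → m ≢ n → not (m <ᵇ n) ≡ (n <ᵇ m)
not-<ᵇ {m} {n} m≢n with <-cmp m n
... | tri< m<n _ n≮m rewrite <ᵇ-true m<n | <ᵇ-false n≮m = refl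
... | tri≈ _ m≡n _ = contradiction m≡n m≢n
... | tri> m≮n _ n<m rewrite <ᵇ-false m≮n | <ᵇ-true n<m = refl

≡ᵇ-true : ∀ {m n} → m ≡ n → (m ≡ᵇ n) ≡ true
≡ᵇ-true {m} {n} m≡n = Equivalence.to T-≡ (≡⇒≡ᵇ m n m≡n)

≡ᵇ-false : ∀ {m n} → m ≢ n → (m ≡ᵇ n) ≡ false
≡ᵇ-false {m} {n} m≢n with m ≡ᵇ n in eq
... | false = refl
... | true  = contradiction (≡ᵇ⇒≡ m n (subst T (sym eq) tt)) m≢n

≡ᵇ1-false : ∀ {n} → 2 ≤ n → (n ≡ᵇ 1) ≡ false
≡ᵇ1-false 2≤n = ≡ᵇ-false (λ n≡1 → <⇒≱ 2≤n (≤-reflexive n≡1))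

∣m-n∣≡1+∣m-1+n∣ : ∀ {m n} → n < m → ∣ m - n ∣ ≡ suc ∣ m - suc n ∣
∣m-n∣≡1+∣m-1+n∣ {suc m} {zero}  _         = cong suc (sym (∣-∣-identityʳ m))
∣m-n∣≡1+∣m-1+n∣ {suc m} {suc n} (s<s n<m) = ∣m-n∣≡1+∣m-1+n∣ n<m

∣m-1+n∣≡1+∣m-n∣ : ∀ {m n} → m ≤ n → ∣ m - suc n ∣ ≡ suc ∣ m - n ∣
∣m-1+n∣≡1+∣m-n∣ {zero}  _         = refl
∣m-1+n∣≡1+∣m-n∣ {suc m} (s≤s m≤n) = ∣m-1+n∣≡1+∣m-n∣ m≤n

≡1+⊎≡1+⇒≤1+ : ∀ {x y} → x ≡ suc y ⊎ y ≡ suc x → x ≤ suc y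
≡1+⊎≡1+⇒≤1+ (inj₁ refl) = ≤-refl
≡1+⊎≡1+⇒≤1+ (inj₂ refl) = m≤n⇒m≤1+n (n≤1+n _)

∣m-1∣≡n∸2 : ∀ {m n} → m + 1 ≡ n → 2 ≤ n → ∣ m - 1 ∣ ≡ n ∸ 2
∣m-1∣≡n∸2 {zero}  refl (s≤s ())
∣m-1∣≡n∸2 {suc m} refl _ = trans (∣-∣-identityʳ m) (sym (m+n∸n≡m m 1))

≡1+⇒≮ : ∀ {x y} → x ≡ suc y → ¬ x < y
≡1+⇒≮ refl x<y = <-asym x<y (n<1+n _)

count-cong : ∀ {p q : ℕ → Bool} xs → (∀ {x} → x ∈ xs → p x ≡ q x) → count p xs ≡ count q xs
count-cong []       _  = refl
count-cong (x ∷ xs) eq =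
  cong₂ (λ b n → (if b then 1 else 0) + n) (eq (here refl)) (count-cong xs (eq ∘ there))

count-≡0 : ∀ {p : ℕ → Bool} xs → (∀ {x} → x ∈ xs → ¬ T (p x)) → count p xs ≡ 0
count-≡0 []       _  = refl
count-≡0 {p} (x ∷ xs) ¬p with p x in eq
... | true  = contradiction (subst T (sym eq) tt) (¬p (here refl))
... | false = count-≡0 xs (¬p ∘ there)

count-≡1 : ∀ {p : ℕ → Bool} {xs a} → Unique xs → a ∈ xs → T (p a) →
           (∀ {x} → x ∈ xs → T (p x) → x ≡ a) → count p xs ≡ 1
count-≡1 (a∉xs ∷ _) (here refl) pa uniq rewrite Equivalence.to T-≡ pa =
  cong suc (count-≡0 _ λ x∈xs px → All-lookup a∉xs x∈xs (sym (uniq (there x∈xs) px)))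
count-≡1 {p} {x ∷ _} (x∉xs ∷ xs!) (there a∈xs) pa uniq with p x in eq
... | true  = contradiction (uniq (here refl) (subst T (sym eq) tt)) (All-lookup x∉xs a∈xs)
... | false = count-≡1 xs! a∈xs pa (uniq ∘ there)

count-≥1 : ∀ {p : ℕ → Bool} {xs a} → a ∈ xs → T (p a) → 1 ≤ count p xs
count-≥1 (here refl) pa rewrite Equivalence.to T-≡ pa = s≤s z≤n
count-≥1 {p} {x ∷ _} (there a∈xs) pa = ≤-trans (count-≥1 a∈xs pa) (m≤n+m _ (if p x then 1 else 0))

count-≥2 : ∀ {p : ℕ → Bool} {xs a b} → a ∈ xs → b ∈ xs → a ≢ b → T (p a) → T (p b) →
           2 ≤ count p xs
count-≥2     (here refl)  (here refl)  a≢b _  _  = contradiction refl a≢b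
count-≥2     (here refl)  (there b∈xs) _   pa pb rewrite Equivalence.to T-≡ pa = s≤s (count-≥1 b∈xs pb)
count-≥2     (there a∈xs) (here refl)  _   pa pb rewrite Equivalence.to T-≡ pb = s≤s (count-≥1 a∈xs pa)
count-≥2 {p} {x ∷ _} (there a∈xs) (there b∈xs) a≢b pa pb =
  ≤-trans (count-≥2 a∈xs b∈xs a≢b pa pb) (m≤n+m _ (if p x then 1 else 0))

count-∧-not : ∀ (p q : ℕ → Bool) xs →
              count (λ x → p x ∧ q x) xs + count (λ x → p x ∧ not (q x)) xs ≡ count p xs
count-∧-not p q []       = refl
count-∧-not p q (x ∷ xs) with p x | q x
... | false | _     = count-∧-not p q xs
... | true  | true  = cong suc (count-∧-not p q xs)
... | true  | false = trans (+-suc _ _) (cong suc (count-∧-not p q xs))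

count-++ : ∀ (p : ℕ → Bool) xs ys → count p (xs ++ ys) ≡ count p xs + count p ys
count-++ p xs ys = trans (cong sum (map-++ _ xs ys)) (sum-++ (map _ xs) _)

count-map : ∀ (p : ℕ → Bool) (f : ℕ → ℕ) xs → count p (map f xs) ≡ count (p ∘ f) xs
count-map p f xs = cong sum (sym (map-∘ xs))

applyUpTo-+ : ∀ (f : ℕ → ℕ) m n → applyUpTo f (m + n) ≡ applyUpTo f m ++ applyUpTo (f ∘ (m +_)) n
applyUpTo-+ f zero    n = refl
applyUpTo-+ f (suc m) n = cong (f 0 ∷_) (applyUpTo-+ (f ∘ suc) m n)

upTo-+ : ∀ m n → upTo (m + n) ≡ upTo m ++ map (m +_) (upTo n)
upTo-+ m n = trans (applyUpTo-+ id m n) (cong (upTo m ++_) (sym (map-applyUpTo id (m +_) n)))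

-- Graph distance

firstFrom-cong : ∀ f d {p q : ℕ → Bool} → (∀ x → p x ≡ q x) → firstFrom f d p ≡ firstFrom f d q
firstFrom-cong zero    d _  = refl
firstFrom-cong (suc f) d {p} {q} eq rewrite eq d with q d
... | true  = refl
... | false = firstFrom-cong f (suc d) eq

firstFrom-≤ᵇ : ∀ f d m → d ≤ m → m ≤ d + f → firstFrom f d (m ≤ᵇ_) ≡ m
firstFrom-≤ᵇ zero    d m d≤m m≤d+0 = ≤-antisym d≤m (subst (m ≤_) (+-identityʳ d) m≤d+0)
firstFrom-≤ᵇ (suc f) d m d≤m m≤d+1+f with m ≤ᵇ d in eq
... | true  = ≤-antisym d≤m (≤ᵇ⇒≤ m d (subst T (sym eq) tt))
... | false = firstFrom-≤ᵇ f (suc d) m d<m (subst (m ≤_) (+-suc d f) m≤d+1+f)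
  where d<m = ≰⇒> (λ m≤d → subst T eq (≤⇒≤ᵇ m≤d))

pair-≡ᵇ⇒≡ : ∀ {a b x y} → T ((a ≡ᵇ x) ∧ (b ≡ᵇ y)) → (a , b) ≡ (x , y)
pair-≡ᵇ⇒≡ {a} {b} {x} {y} eq with Equivalence.to T-∧ eq
... | a≡x , b≡y = cong₂ _,_ (≡ᵇ⇒≡ a x a≡x) (≡ᵇ⇒≡ b y b≡y)

pair-≡ᵇ-refl : ∀ a b → T ((a ≡ᵇ a) ∧ (b ≡ᵇ b))
pair-≡ᵇ-refl a b = Equivalence.from T-∧ (≡⇒≡ᵇ a a refl , ≡⇒≡ᵇ b b refl)

adj⇒∈ : ∀ G {u v} → T (adj G u v) → (u , v) ∈ edges G ⊎ (v , u) ∈ edges G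
adj⇒∈ G u~v with find (any⁻ _ (edges G) u~v)
... | (a , b) , ab∈ , match with Equivalence.to T-∨ match
... | inj₁ ab≡uv = inj₁ (subst (_∈ edges G) (pair-≡ᵇ⇒≡ ab≡uv) ab∈)
... | inj₂ ab≡vu = inj₂ (subst (_∈ edges G) (pair-≡ᵇ⇒≡ ab≡vu) ab∈)

∈⇒adj : ∀ G {u v} → (u , v) ∈ edges G ⊎ (v , u) ∈ edges G → T (adj G u v)
∈⇒adj G {u} {v} (inj₁ uv∈) = any⁺ _ (lose uv∈ (Equivalence.from T-∨ (inj₁ (pair-≡ᵇ-refl u v))))
∈⇒adj G {u} {v} (inj₂ vu∈) = any⁺ _ (lose vu∈ (Equivalence.from T-∨ (inj₂ (pair-≡ᵇ-refl v u))))

record IsGraphDistance (G : Graph) (D : ℕ → ℕ → ℕ) : Set where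
  field
    D-self  : ∀ {v} → v < order G → D v v ≡ 0
    D≡0⇒≡   : ∀ {s v} → s < order G → v < order G → D s v ≡ 0 → s ≡ v
    D-adj   : ∀ {s x v} → s < order G → T (adj G x v) → D s v ≤ suc (D s x)
    D-pred  : ∀ {s v m} → s < order G → v < order G → D s v ≡ suc m →
              ∃[ x ] x < order G × T (adj G x v) × D s x ≡ m
    D<order : ∀ {s v} → s < order G → v < order G → D s v < order G

module _ {G : Graph} {D : ℕ → ℕ → ℕ} (isDist : IsGraphDistance G D) where
  open IsGraphDistance isDist

  within⇔ : ∀ d {s v} → s < order G → v < order G → T (within G d s v) ⇔ D s v ≤ d
  within⇔ zero {s} {v} s<n v<n = mk⇔ to from
    where
    to : T (s ≡ᵇ v) → D s v ≤ 0
    to s≡ᵇv rewrite ≡ᵇ⇒≡ s v s≡ᵇv = ≤-reflexive (D-self v<n)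
    from : D s v ≤ 0 → T (s ≡ᵇ v)
    from D≤0 = ≡⇒≡ᵇ s v (D≡0⇒≡ s<n v<n (n≤0⇒n≡0 D≤0))
  within⇔ (suc d) {s} {v} s<n v<n = mk⇔ to from
    where
    to : T (within G (suc d) s v) → D s v ≤ suc d
    to w with Equivalence.to T-∨ w
    ... | inj₁ w-d = m≤n⇒m≤1+n (Equivalence.to (within⇔ d s<n v<n) w-d)
    ... | inj₂ w-any with find (any⁻ _ (vertices G) w-any)
    ... | x , x∈ , wx with Equivalence.to T-∧ wx
    ... | w-sx , x~v =
      ≤-trans (D-adj s<n x~v) (s≤s (Equivalence.to (within⇔ d s<n (∈-upTo⁻ x∈)) w-sx))
    from : D s v ≤ suc d → T (within G (suc d) s v)
    from D≤1+d with m≤n⇒m<n∨m≡n D≤1+d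
    ... | inj₁ (s≤s D≤d) = Equivalence.from T-∨ (inj₁ (Equivalence.from (within⇔ d s<n v<n) D≤d))
    ... | inj₂ D≡1+d with D-pred s<n v<n D≡1+d
    ... | x , x<n , x~v , Dsx≡d =
      Equivalence.from T-∨ (inj₂ (any⁺ _ (lose (∈-upTo⁺ x<n)
        (Equivalence.from T-∧ (Equivalence.from (within⇔ d s<n x<n) (≤-reflexive Dsx≡d) , x~v)))))

  dist≡ : ∀ {s v} → s < order G → v < order G → dist G s v ≡ D s v
  dist≡ {s} {v} s<n v<n = begin
    firstFrom (order G) 0 (λ d → within G d s v)
      ≡⟨ firstFrom-cong (order G) 0 within≡ ⟩
    firstFrom (order G) 0 (D s v ≤ᵇ_)
      ≡⟨ firstFrom-≤ᵇ (order G) 0 (D s v) z≤n (<⇒≤ (D<order s<n v<n)) ⟩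
    D s v ∎
    where
    open ≡-Reasoning
    within≡ : ∀ d → within G d s v ≡ (D s v ≤ᵇ d)
    within≡ d = T-⇔⇒≡ (≤⇒≤ᵇ ∘ Equivalence.to (within⇔ d s<n v<n))
                      (Equivalence.from (within⇔ d s<n v<n) ∘ ≤ᵇ⇒≤ _ _)

ℓ-+-ℓ : ∀ G u v → (∀ {w} → w < order G → dist G w u ≢ dist G w v) →
        ℓ G u v + ℓ G v u ≡ count (pendent G) (vertices G)
ℓ-+-ℓ G u v no-tie = begin
  ℓ G u v + ℓ G v u
    ≡⟨ cong (ℓ G u v +_) (count-cong (vertices G) λ w∈ →
         cong (pendent G _ ∧_) (sym (not-<ᵇ (no-tie (∈-upTo⁻ w∈))))) ⟩
  ℓ G u v + count (λ w → pendent G w ∧ not (dist G w u <ᵇ dist G w v)) (vertices G)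
    ≡⟨ count-∧-not (pendent G) (λ w → dist G w u <ᵇ dist G w v) (vertices G) ⟩
  count (pendent G) (vertices G) ∎
  where open ≡-Reasoning

MoT-const : ∀ G c → (∀ {u v} → (u , v) ∈ edges G → ∣ ℓ G u v - ℓ G v u ∣ ≡ c) →
            MoT G ≡ length (edges G) * c
MoT-const G c term = go (edges G) term
  where
  go : ∀ es → (∀ {u v} → (u , v) ∈ es → ∣ ℓ G u v - ℓ G v u ∣ ≡ c) →
       sum (map (λ { (u , v) → ∣ ℓ G u v - ℓ G v u ∣ }) es) ≡ length es * c
  go []             _    = refl
  go ((u , v) ∷ es) term = cong₂ _+_ (term (here refl)) (go es (term ∘ there))

-- Coordinates on a spider

-- at i e lies on leg i at distance suc e from the centre; the leg lengths only enter through Valid.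
data Pos (k : ℕ) : Set where
  centre : Pos k
  at     : Fin k → ℕ → Pos k

parent : ∀ {k} → Fin k → ℕ → Pos k
parent i zero    = centre
parent i (suc e) = at i e

shift : ∀ {k} → Pos k → Pos (suc k)
shift centre   = centre
shift (at i e) = at (suc i) e

Valid : (ls : List ℕ) → Pos (length ls) → Set
Valid ls centre   = ⊤
Valid ls (at i e) = e < lookup ls i

isLeaf : (ls : List ℕ) → Pos (length ls) → Bool
isLeaf ls centre   = false
isLeaf ls (at i e) = suc e ≡ᵇ lookup ls i

start : (ls : List ℕ) → Fin (length ls) → ℕ
start (L ∷ ls) zero    = 0
start (L ∷ ls) (suc i) = L + start ls i

-- The labelling used by Defs.spiderEdges o, whose first leg begins at vertex o.
vertexFrom : ℕ → (ls : List ℕ) → Pos (length ls) → ℕ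
vertexFrom o ls centre   = 0
vertexFrom o ls (at i e) = o + (start ls i + e)

vertex : (ls : List ℕ) → Pos (length ls) → ℕ
vertex = vertexFrom 1

locate : (ls : List ℕ) → ℕ → Pos (length ls)
locate []       x = centre
locate (L ∷ ls) x with x <? L
... | yes _ = at zero x
... | no  _ = shift (locate ls (x ∸ L))

pos : (ls : List ℕ) → ℕ → Pos (length ls)
pos ls zero    = centre
pos ls (suc x) = locate ls x

Valid-shift : ∀ L ls {P : Pos (length ls)} → Valid ls P → Valid (L ∷ ls) (shift P)
Valid-shift L ls {centre} _ = tt
Valid-shift L ls {at i e} v = v

vertexFrom-shift : ∀ o L ls (P : Pos (length ls)) →
                   vertexFrom o (L ∷ ls) (shift P) ≡ vertexFrom (o + L) ls P
vertexFrom-shift o L ls centre   = refl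
vertexFrom-shift o L ls (at i e) = begin
  o + ((L + start ls i) + e) ≡⟨ cong (o +_) (+-assoc L (start ls i) e) ⟩
  o + (L + (start ls i + e)) ≡⟨ +-assoc o L _ ⟨
  o + L + (start ls i + e)   ∎
  where open ≡-Reasoning

start+lookup≤sum : ∀ ls i → start ls i + lookup ls i ≤ sum ls
start+lookup≤sum (L ∷ ls) zero    = m≤m+n L (sum ls)
start+lookup≤sum (L ∷ ls) (suc i) =
  subst (_≤ L + sum ls) (sym (+-assoc L _ _)) (+-monoʳ-≤ L (start+lookup≤sum ls i))

lookup≤sum : ∀ ls i → lookup ls i ≤ sum ls
lookup≤sum ls i = ≤-trans (m≤n+m _ (start ls i)) (start+lookup≤sum ls i)

lookup+lookup≤sum : ∀ ls {i j} → i ≢ j → lookup ls i + lookup ls j ≤ sum ls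
lookup+lookup≤sum (L ∷ ls) {zero}  {zero}  i≢j = contradiction refl i≢j
lookup+lookup≤sum (L ∷ ls) {zero}  {suc j} _   = +-monoʳ-≤ L (lookup≤sum ls j)
lookup+lookup≤sum (L ∷ ls) {suc i} {zero}  _   =
  subst (_≤ L + sum ls) (+-comm L _) (+-monoʳ-≤ L (lookup≤sum ls i))
lookup+lookup≤sum (L ∷ ls) {suc i} {suc j} i≢j =
  ≤-trans (lookup+lookup≤sum ls (i≢j ∘ cong suc)) (m≤n+m (sum ls) L)

vertex<order : ∀ ls {P} → Valid ls P → vertex ls P < suc (sum ls)
vertex<order ls {centre} _   = z<s
vertex<order ls {at i e} e<L = s<s (≤-trans (+-monoʳ-< (start ls i) e<L) (start+lookup≤sum ls i))

locate-first : ∀ L ls {x} → x < L → locate (L ∷ ls) x ≡ at zero x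
locate-first L ls {x} x<L with x <? L
... | yes _   = refl
... | no  x≮L = contradiction x<L x≮L

locate-rest : ∀ L ls y → locate (L ∷ ls) (L + y) ≡ shift (locate ls y)
locate-rest L ls y with L + y <? L
... | yes L+y<L = contradiction L+y<L (m+n≮m L y)
... | no  _     = cong (shift ∘ locate ls) (m+n∸m≡n L y)

locate-at : ∀ ls i e → e < lookup ls i → locate ls (start ls i + e) ≡ at i e
locate-at (L ∷ ls) zero    e e<L = locate-first L ls e<L
locate-at (L ∷ ls) (suc i) e e<L = begin
  locate (L ∷ ls) (L + start ls i + e)   ≡⟨ cong (locate (L ∷ ls)) (+-assoc L _ e) ⟩
  locate (L ∷ ls) (L + (start ls i + e)) ≡⟨ locate-rest L ls _ ⟩
  shift (locate ls (start ls i + e))     ≡⟨ cong shift (locate-at ls i e e<L) ⟩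
  at (suc i) e                           ∎
  where open ≡-Reasoning

pos-vertex : ∀ ls {P} → Valid ls P → pos ls (vertex ls P) ≡ P
pos-vertex ls {centre} _   = refl
pos-vertex ls {at i e} e<L = locate-at ls i e e<L

vertexFrom-locate : ∀ o ls x → x < sum ls →
                    Valid ls (locate ls x) × vertexFrom o ls (locate ls x) ≡ o + x
vertexFrom-locate o (L ∷ ls) x x<L+Σ with x <? L
... | yes x<L = x<L , refl
... | no  x≮L with vertexFrom-locate (o + L) ls (x ∸ L)
                     (subst (x ∸ L <_) (m+n∸m≡n L (sum ls)) (∸-monoˡ-< x<L+Σ (≮⇒≥ x≮L)))
... | valid , vertexFrom≡ = Valid-shift L ls valid , (begin
  vertexFrom o (L ∷ ls) (shift (locate ls (x ∸ L))) ≡⟨ vertexFrom-shift o L ls (locate ls (x ∸ L)) ⟩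
  vertexFrom (o + L) ls (locate ls (x ∸ L))         ≡⟨ vertexFrom≡ ⟩
  o + L + (x ∸ L)                                   ≡⟨ +-assoc o L _ ⟩
  o + (L + (x ∸ L))                                 ≡⟨ cong (o +_) (m+[n∸m]≡n (≮⇒≥ x≮L)) ⟩
  o + x                                             ∎)
  where open ≡-Reasoning

vertex-pos : ∀ ls {x} → x < suc (sum ls) → Valid ls (pos ls x) × vertex ls (pos ls x) ≡ x
vertex-pos ls {zero}  _         = tt , refl
vertex-pos ls {suc x} (s<s x<Σ) = vertexFrom-locate 1 ls x x<Σ

vertex-injective : ∀ ls {P Q} → Valid ls P → Valid ls Q → vertex ls P ≡ vertex ls Q → P ≡ Q
vertex-injective ls vP vQ eq = trans (sym (pos-vertex ls vP)) (trans (cong (pos ls) eq) (pos-vertex ls vQ))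

-- Distance on a spider

spiderDist : ∀ {k} → Pos k → Pos k → ℕ
spiderDist centre   centre   = 0
spiderDist centre   (at j e) = suc e
spiderDist (at i d) centre   = suc d
spiderDist (at i d) (at j e) with i Fin.≟ j
... | yes _ = ∣ d - e ∣
... | no  _ = suc d + suc e

spiderDist-sameLeg : ∀ {k} (i : Fin k) d e → spiderDist (at i d) (at i e) ≡ ∣ d - e ∣
spiderDist-sameLeg i d e with i Fin.≟ i
... | yes _   = refl
... | no  i≢i = contradiction refl i≢i

spiderDist-otherLeg : ∀ {k} {i j : Fin k} d e → i ≢ j → spiderDist (at i d) (at j e) ≡ suc d + suc e
spiderDist-otherLeg {i = i} {j} d e i≢j with i Fin.≟ j
... | yes i≡j = contradiction i≡j i≢j
... | no  _   = refl

spiderDist-self : ∀ {k} (P : Pos k) → spiderDist P P ≡ 0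
spiderDist-self centre   = refl
spiderDist-self (at i d) = trans (spiderDist-sameLeg i d d) (∣n-n∣≡0 d)

spiderDist≡0⇒≡ : ∀ {k} (P Q : Pos k) → spiderDist P Q ≡ 0 → P ≡ Q
spiderDist≡0⇒≡ centre   centre   _  = refl
spiderDist≡0⇒≡ (at i d) (at j e) eq with i Fin.≟ j
... | yes refl = cong (at i) (∣m-n∣≡0⇒m≡n eq)

spiderDist≤sum : ∀ ls {P Q} → Valid ls P → Valid ls Q → spiderDist P Q ≤ sum ls
spiderDist≤sum ls {centre} {centre} _   _   = z≤n
spiderDist≤sum ls {centre} {at j e} _   e<L = ≤-trans e<L (lookup≤sum ls j)
spiderDist≤sum ls {at i d} {centre} d<L _   = ≤-trans d<L (lookup≤sum ls i)
spiderDist≤sum ls {at i d} {at j e} d<L e<L with i Fin.≟ j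
... | yes refl = ≤-trans (∣m-n∣≤m⊔n d e) (≤-trans (⊔-lub (<⇒≤ d<L) (<⇒≤ e<L)) (lookup≤sum ls i))
... | no  i≢j  = ≤-trans (+-mono-≤ d<L e<L) (lookup+lookup≤sum ls i≢j)

module _ {k : ℕ} where

  spiderDist-centre-at : ∀ (i : Fin k) e → spiderDist centre (at i e) ≡ suc (spiderDist centre (parent i e))
  spiderDist-centre-at i zero    = refl
  spiderDist-centre-at i (suc e) = refl

  spiderDist-otherLeg-at : ∀ {i j : Fin k} d e → j ≢ i →
                           spiderDist (at j d) (at i e) ≡ suc (spiderDist (at j d) (parent i e))
  spiderDist-otherLeg-at d zero    j≢i rewrite spiderDist-otherLeg d 0 j≢i = +-comm (suc d) 1
  spiderDist-otherLeg-at d (suc e) j≢i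
    rewrite spiderDist-otherLeg d (suc e) j≢i | spiderDist-otherLeg d e j≢i = +-suc (suc d) (suc e)

  spiderDist-above-at : ∀ (i : Fin k) {d e} → d < e →
                        spiderDist (at i d) (at i e) ≡ suc (spiderDist (at i d) (parent i e))
  spiderDist-above-at i {d} {suc e} (s≤s d≤e)
    rewrite spiderDist-sameLeg i d (suc e) | spiderDist-sameLeg i d e = ∣m-1+n∣≡1+∣m-n∣ d≤e

  spiderDist-below-parent : ∀ (i : Fin k) {d e} → e ≤ d →
                            spiderDist (at i d) (parent i e) ≡ suc (spiderDist (at i d) (at i e))
  spiderDist-below-parent i {d} {zero}  _
    rewrite spiderDist-sameLeg i d 0 = cong suc (sym (∣-∣-identityʳ d))
  spiderDist-below-parent i {d} {suc e} e<d
    rewrite spiderDist-sameLeg i d e | spiderDist-sameLeg i d (suc e) = ∣m-n∣≡1+∣m-1+n∣ e<d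

  spiderDist-edge : ∀ (S : Pos k) i e →
                    spiderDist S (at i e) ≡ suc (spiderDist S (parent i e)) ⊎
                    spiderDist S (parent i e) ≡ suc (spiderDist S (at i e))
  spiderDist-edge centre   i e = inj₁ (spiderDist-centre-at i e)
  spiderDist-edge (at j d) i e = fromLeg (j Fin.≟ i)
    where
    fromLeg : ∀ {j} → Dec (j ≡ i) →
              spiderDist (at j d) (at i e) ≡ suc (spiderDist (at j d) (parent i e)) ⊎
              spiderDist (at j d) (parent i e) ≡ suc (spiderDist (at j d) (at i e))
    fromLeg (no j≢i) = inj₁ (spiderDist-otherLeg-at d e j≢i)
    fromLeg (yes refl) with d <? e
    ... | yes d<e = inj₁ (spiderDist-above-at i d<e)
    ... | no  d≮e = inj₂ (spiderDist-below-parent i (≮⇒≥ d≮e))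

data Edge (ls : List ℕ) : Pos (length ls) → Pos (length ls) → Set where
  edge : ∀ {i e} → e < lookup ls i → Edge ls (parent i e) (at i e)

Adjacent : (ls : List ℕ) → Pos (length ls) → Pos (length ls) → Set
Adjacent ls P Q = Edge ls P Q ⊎ Edge ls Q P

Edge-valid : ∀ {ls P Q} → Edge ls P Q → Valid ls P × Valid ls Q
Edge-valid (edge {e = zero}  e<L) = tt , e<L
Edge-valid (edge {e = suc e} e<L) = <-trans (n<1+n e) e<L , e<L

spiderDist-adjacent : ∀ {ls P Q} (S : Pos (length ls)) → Adjacent ls P Q →
                      spiderDist S Q ≤ suc (spiderDist S P)
spiderDist-adjacent S (inj₁ (edge {i} {e} _)) = ≡1+⊎≡1+⇒≤1+ (spiderDist-edge S i e)
spiderDist-adjacent S (inj₂ (edge {i} {e} _)) = ≡1+⊎≡1+⇒≤1+ (Sum.swap (spiderDist-edge S i e))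

CloserNeighbour : (ls : List ℕ) → Pos (length ls) → Pos (length ls) → ℕ → Set
CloserNeighbour ls S Q m = ∃[ X ] Valid ls X × Adjacent ls X Q × spiderDist S X ≡ m

parent-closer : ∀ ls {S i e m} → e < lookup ls i → spiderDist S (at i e) ≡ suc m →
                spiderDist S (at i e) ≡ suc (spiderDist S (parent i e)) → CloserNeighbour ls S (at i e) m
parent-closer ls e<L eq step =
  _ , proj₁ (Edge-valid (edge e<L)) , inj₁ (edge e<L) , suc-injective (trans (sym step) eq)

child-closer : ∀ ls {i d e m} → d < lookup ls i → e ≤ d → spiderDist (at i d) (parent i e) ≡ suc m →
               CloserNeighbour ls (at i d) (parent i e) m
child-closer ls {i} d<L e≤d eq =
  at i _ , ≤-<-trans e≤d d<L , inj₂ (edge (≤-<-trans e≤d d<L)) ,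
  suc-injective (trans (sym (spiderDist-below-parent i e≤d)) eq)

spiderDist-pred : ∀ ls {S Q} m → Valid ls S → Valid ls Q → spiderDist S Q ≡ suc m →
                  CloserNeighbour ls S Q m
spiderDist-pred ls {at j d} {centre}   m d<L _   eq = child-closer ls {e = 0} d<L z≤n eq
spiderDist-pred ls {centre} {at i e}   m _   e<L eq = parent-closer ls {centre} e<L eq (spiderDist-centre-at i e)
spiderDist-pred ls {at j d} {at i e}   m d<L e<L eq = fromLeg d<L eq (j Fin.≟ i)
  where
  fromLeg : ∀ {j} → d < lookup ls j → spiderDist (at j d) (at i e) ≡ suc m → Dec (j ≡ i) →
            CloserNeighbour ls (at j d) (at i e) m
  fromLeg _   eq (no j≢i) = parent-closer ls e<L eq (spiderDist-otherLeg-at d e j≢i)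
  fromLeg d<L eq (yes refl) with <-cmp d e
  ... | tri< d<e _ _ = parent-closer ls e<L eq (spiderDist-above-at i d<e)
  ... | tri≈ _ refl _ = contradiction (trans (sym eq) (spiderDist-self (at i d))) (λ ())
  ... | tri> _ _ e<d = child-closer ls {e = suc e} d<L e<d eq

parent-shift : ∀ {k} (i : Fin k) e → parent (suc i) e ≡ shift (parent i e)
parent-shift i zero    = refl
parent-shift i (suc e) = refl

Edge-shift : ∀ L ls {P Q} → Edge ls P Q → Edge (L ∷ ls) (shift P) (shift Q)
Edge-shift L ls (edge {i} {e} e<L) = subst (λ P → Edge (L ∷ ls) P (at (suc i) e)) (parent-shift i e) (edge e<L)

∈-pathEdges⁻ : ∀ p L {a b} → (a , b) ∈ pathEdges p L → ∃[ t ] t < L × a ≡ p + t × b ≡ p + suc t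
∈-pathEdges⁻ p (suc L) (here refl) = 0 , z<s , sym (+-identityʳ p) , sym (+-comm p 1)
∈-pathEdges⁻ p (suc L) (there ab∈) with ∈-pathEdges⁻ (suc p) L ab∈
... | t , t<L , refl , refl = suc t , s<s t<L , sym (+-suc p t) , sym (+-suc p (suc t))

∈-pathEdges⁺ : ∀ p L {t} → t < L → (p + t , p + suc t) ∈ pathEdges p L
∈-pathEdges⁺ p (suc L) {zero}  _         rewrite +-identityʳ p | +-comm p 1 = here refl
∈-pathEdges⁺ p (suc L) {suc t} (s<s t<L) rewrite +-suc p t | +-suc p (suc t) =
  there (∈-pathEdges⁺ (suc p) L t<L)

∈-spiderEdges⁻ : ∀ o ls {a b} → (a , b) ∈ spiderEdges o ls →
                 ∃[ P ] ∃[ Q ] Edge ls P Q × vertexFrom o ls P ≡ a × vertexFrom o ls Q ≡ b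
∈-spiderEdges⁻ o (L ∷ ls) ab∈ with ∈-++⁻ (legEdges o L) ab∈
∈-spiderEdges⁻ o (suc L ∷ ls) _ | inj₁ (here refl) = centre , at zero 0 , edge z<s , refl , +-identityʳ o
∈-spiderEdges⁻ o (suc L ∷ ls) _ | inj₁ (there ab∈) with ∈-pathEdges⁻ o L ab∈
... | t , t<L , refl , refl = at zero t , at zero (suc t) , edge (s<s t<L) , refl , refl
∈-spiderEdges⁻ o (L ∷ ls) _ | inj₂ ab∈ with ∈-spiderEdges⁻ (o + L) ls ab∈
... | P , Q , P→Q , refl , refl =
  shift P , shift Q , Edge-shift L ls P→Q , vertexFrom-shift o L ls P , vertexFrom-shift o L ls Q

∈-spiderEdges⁺ : ∀ o ls {P Q} → Edge ls P Q → (vertexFrom o ls P , vertexFrom o ls Q) ∈ spiderEdges o ls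
∈-spiderEdges⁺ o (suc L ∷ ls) (edge {zero} {zero}  _)   rewrite +-identityʳ o = here refl
∈-spiderEdges⁺ o (suc L ∷ ls) (edge {zero} {suc t} (s<s t<L)) = there (∈-++⁺ˡ (∈-pathEdges⁺ o L t<L))
∈-spiderEdges⁺ o (L ∷ ls) (edge {suc i} {e} e<L) =
  ∈-++⁺ʳ (legEdges o L) (subst (_∈ spiderEdges (o + L) ls) (sym (cong₂ _,_ parent≡ at≡))
                                (∈-spiderEdges⁺ (o + L) ls (edge e<L)))
  where
  parent≡ = trans (cong (vertexFrom o (L ∷ ls)) (parent-shift i e)) (vertexFrom-shift o L ls (parent i e))
  at≡     = vertexFrom-shift o L ls (at i e)

length-spiderEdges : ∀ o ls → length (spiderEdges o ls) ≡ sum ls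
length-spiderEdges o []       = refl
length-spiderEdges o (L ∷ ls) =
  trans (length-++ (legEdges o L)) (cong₂ _+_ (length-legEdges o L) (length-spiderEdges (o + L) ls))
  where
  length-pathEdges : ∀ p L → length (pathEdges p L) ≡ L
  length-pathEdges p zero    = refl
  length-pathEdges p (suc L) = cong suc (length-pathEdges (suc p) L)
  length-legEdges : ∀ o L → length (legEdges o L) ≡ L
  length-legEdges o zero    = refl
  length-legEdges o (suc L) = cong suc (length-pathEdges o L)

module _ (ls : List ℕ) where

  ∈-spiderEdges⇒Edge : ∀ {x v} → (x , v) ∈ spiderEdges 1 ls → Edge ls (pos ls x) (pos ls v)
  ∈-spiderEdges⇒Edge xv∈ with ∈-spiderEdges⁻ 1 ls xv∈
  ... | P , Q , P→Q , refl , refl with Edge-valid P→Q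
  ... | vP , vQ = subst₂ (Edge ls) (sym (pos-vertex ls vP)) (sym (pos-vertex ls vQ)) P→Q

  adj⇒Adjacent : ∀ {x v} → T (adj (spider ls) x v) → Adjacent ls (pos ls x) (pos ls v)
  adj⇒Adjacent = Sum.map ∈-spiderEdges⇒Edge ∈-spiderEdges⇒Edge ∘ adj⇒∈ (spider ls)

  Adjacent⇒adj : ∀ {P Q} → Adjacent ls P Q → T (adj (spider ls) (vertex ls P) (vertex ls Q))
  Adjacent⇒adj (inj₁ P→Q) = ∈⇒adj (spider ls) (inj₁ (∈-spiderEdges⁺ 1 ls P→Q))
  Adjacent⇒adj (inj₂ Q→P) = ∈⇒adj (spider ls) (inj₂ (∈-spiderEdges⁺ 1 ls Q→P))

  isGraphDistance : IsGraphDistance (spider ls) (λ s v → spiderDist (pos ls s) (pos ls v))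
  isGraphDistance = record
    { D-self  = λ {v} _ → spiderDist-self (pos ls v)
    ; D≡0⇒≡   = D≡0⇒≡
    ; D-adj   = λ {s} _ x~v → spiderDist-adjacent (pos ls s) (adj⇒Adjacent x~v)
    ; D-pred  = D-pred
    ; D<order = λ s<n v<n → s≤s (spiderDist≤sum ls (proj₁ (vertex-pos ls s<n)) (proj₁ (vertex-pos ls v<n)))
    }
    where
    D≡0⇒≡ : ∀ {s v} → s < suc (sum ls) → v < suc (sum ls) →
            spiderDist (pos ls s) (pos ls v) ≡ 0 → s ≡ v
    D≡0⇒≡ {s} {v} s<n v<n D≡0 = begin
      s                    ≡⟨ proj₂ (vertex-pos ls s<n) ⟨
      vertex ls (pos ls s) ≡⟨ cong (vertex ls) (spiderDist≡0⇒≡ (pos ls s) (pos ls v) D≡0) ⟩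
      vertex ls (pos ls v) ≡⟨ proj₂ (vertex-pos ls v<n) ⟩
      v                    ∎
      where open ≡-Reasoning
    D-pred : ∀ {s v m} → s < suc (sum ls) → v < suc (sum ls) → spiderDist (pos ls s) (pos ls v) ≡ suc m →
           ∃[ x ] x < suc (sum ls) × T (adj (spider ls) x v) × spiderDist (pos ls s) (pos ls x) ≡ m
    D-pred {s} {v} s<n v<n eq with spiderDist-pred ls _ (proj₁ (vertex-pos ls s<n)) (proj₁ (vertex-pos ls v<n)) eq
    ... | X , vX , X~v , Dsx≡m =
      vertex ls X , vertex<order ls vX ,
      subst (λ v → T (adj (spider ls) (vertex ls X) v)) (proj₂ (vertex-pos ls v<n)) (Adjacent⇒adj X~v) ,
      trans (cong (spiderDist (pos ls s)) (pos-vertex ls vX)) Dsx≡m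

  dist-spider : ∀ {s v} → s < suc (sum ls) → v < suc (sum ls) →
                dist (spider ls) s v ≡ spiderDist (pos ls s) (pos ls v)
  dist-spider = dist≡ isGraphDistance

-- Pendent vertices of a spider

Adjacent-at : ∀ {ls i e R} → Adjacent ls (at i e) R →
              R ≡ parent i e ⊎ (R ≡ at i (suc e) × suc e < lookup ls i)
Adjacent-at (inj₁ at→R) = inj₂ (child at→R refl)
  where
  child : ∀ {ls P R i e} → Edge ls P R → P ≡ at i e → R ≡ at i (suc e) × suc e < lookup ls i
  child (edge {e = suc e} e<L) refl = refl , e<L
Adjacent-at (inj₂ (edge _)) = inj₁ refl

adj-vertex⇒Adjacent : ∀ ls {P x} → Valid ls P → T (adj (spider ls) (vertex ls P) x) →
                      Adjacent ls P (pos ls x)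
adj-vertex⇒Adjacent ls vP P~x = subst (λ P → Adjacent ls P _) (pos-vertex ls vP) (adj⇒Adjacent ls P~x)

2≤degree : ∀ ls {P Q R} → Valid ls Q → Valid ls R → Q ≢ R → Adjacent ls P Q → Adjacent ls P R →
           2 ≤ degree (spider ls) (vertex ls P)
2≤degree ls vQ vR Q≢R P~Q P~R =
  count-≥2 (∈-upTo⁺ (vertex<order ls vQ)) (∈-upTo⁺ (vertex<order ls vR))
           (Q≢R ∘ vertex-injective ls vQ vR) (Adjacent⇒adj ls P~Q) (Adjacent⇒adj ls P~R)

degree-leaf≡1 : ∀ ls {i e} → suc e ≡ lookup ls i → degree (spider ls) (vertex ls (at i e)) ≡ 1
degree-leaf≡1 ls {i} {e} leaf =
  count-≡1 (upTo⁺ _) (∈-upTo⁺ (vertex<order ls (proj₁ (Edge-valid (edge e<L)))))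
           (Adjacent⇒adj ls (inj₂ (edge e<L))) onlyParent
  where
  e<L = ≤-reflexive leaf
  onlyParent : ∀ {x} → x ∈ upTo (suc (sum ls)) → T (adj (spider ls) (vertex ls (at i e)) x) →
               x ≡ vertex ls (parent i e)
  onlyParent {x} x∈ P~x with Adjacent-at (adj-vertex⇒Adjacent ls e<L P~x)
  ... | inj₁ x↦parent = trans (sym (proj₂ (vertex-pos ls (∈-upTo⁻ x∈)))) (cong (vertex ls) x↦parent)
  ... | inj₂ (_ , 1+e<L) = contradiction (subst (suc e <_) (sym leaf) 1+e<L) (<-irrefl refl)

pendent-spider : ∀ ls → All (1 ≤_) ls → 2 ≤ length ls → ∀ {P} → Valid ls P →
                 pendent (spider ls) (vertex ls P) ≡ isLeaf ls P
pendent-spider (L₀ ∷ L₁ ∷ ls) (0<L₀ ∷ 0<L₁ ∷ _) _ {centre} _ =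
  ≡ᵇ1-false (2≤degree (L₀ ∷ L₁ ∷ ls) {Q = at zero 0} {R = at (suc zero) 0} 0<L₀ 0<L₁ (λ ())
                      (inj₁ (edge 0<L₀)) (inj₁ (edge 0<L₁)))
pendent-spider (_ ∷ []) _ (s≤s ()) {centre} _
pendent-spider ls _ _ {at i e} e<L with m≤n⇒m<n∨m≡n e<L
... | inj₁ 1+e<L =
  trans (≡ᵇ1-false (2≤degree ls vParent 1+e<L (parent≢child e) (inj₂ (edge e<L)) (inj₁ (edge 1+e<L))))
        (sym (≡ᵇ-false (<⇒≢ 1+e<L)))
  where
  vParent = proj₁ (Edge-valid (edge e<L))
  parent≢child : ∀ e → parent i e ≢ at i (suc e)
  parent≢child zero    ()
  parent≢child (suc e) ()
... | inj₂ leaf = trans (cong (_≡ᵇ 1) (degree-leaf≡1 ls leaf)) (sym (≡ᵇ-true leaf))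

isLeaf-shift : ∀ L ls (P : Pos (length ls)) → isLeaf (L ∷ ls) (shift P) ≡ isLeaf ls P
isLeaf-shift L ls centre   = refl
isLeaf-shift L ls (at i e) = refl

count-firstLeg-leaves : ∀ L ls → 1 ≤ L → count (isLeaf (L ∷ ls) ∘ locate (L ∷ ls)) (upTo L) ≡ 1
count-firstLeg-leaves (suc L) ls _ = count-≡1 (upTo⁺ (suc L)) (∈-upTo⁺ (n<1+n L)) lastIsLeaf onlyLast
  where
  lastIsLeaf : T (isLeaf (suc L ∷ ls) (locate (suc L ∷ ls) L))
  lastIsLeaf rewrite locate-first (suc L) ls (n<1+n L) = ≡⇒≡ᵇ L L refl
  onlyLast : ∀ {x} → x ∈ upTo (suc L) → T (isLeaf (suc L ∷ ls) (locate (suc L ∷ ls) x)) → x ≡ L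
  onlyLast {x} x∈ leaf rewrite locate-first (suc L) ls (∈-upTo⁻ x∈) = ≡ᵇ⇒≡ x L leaf

count-leaves : ∀ ls → All (1 ≤_) ls → count (isLeaf ls ∘ locate ls) (upTo (sum ls)) ≡ length ls
count-leaves []       []            = refl
count-leaves (L ∷ ls) (0<L ∷ legs≥1) = begin
  count leaf (upTo (L + sum ls))
    ≡⟨ cong (count leaf) (upTo-+ L (sum ls)) ⟩
  count leaf (upTo L ++ map (L +_) (upTo (sum ls)))
    ≡⟨ count-++ leaf (upTo L) _ ⟩
  count leaf (upTo L) + count leaf (map (L +_) (upTo (sum ls)))
    ≡⟨ cong₂ _+_ (count-firstLeg-leaves L ls 0<L) (count-map leaf (L +_) (upTo (sum ls))) ⟩
  1 + count (leaf ∘ (L +_)) (upTo (sum ls))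
    ≡⟨ cong suc (count-cong (upTo (sum ls)) λ {y} _ → otherLegs y) ⟩
  1 + count (isLeaf ls ∘ locate ls) (upTo (sum ls))
    ≡⟨ cong suc (count-leaves ls legs≥1) ⟩
  1 + length ls ∎
  where
  open ≡-Reasoning
  leaf = isLeaf (L ∷ ls) ∘ locate (L ∷ ls)
  otherLegs : ∀ y → leaf (L + y) ≡ isLeaf ls (locate ls y)
  otherLegs y = trans (cong (isLeaf (L ∷ ls)) (locate-rest L ls y)) (isLeaf-shift L ls (locate ls y))

pendent-pos : ∀ ls → All (1 ≤_) ls → 2 ≤ length ls → ∀ {w} → w < suc (sum ls) →
              pendent (spider ls) w ≡ isLeaf ls (pos ls w)
pendent-pos ls legs≥1 k≥2 {w} w<n with vertex-pos ls w<n
... | vP , vertex≡w =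
  subst (λ x → pendent (spider ls) x ≡ isLeaf ls (pos ls w)) vertex≡w (pendent-spider ls legs≥1 k≥2 vP)

count-pendent : ∀ ls → All (1 ≤_) ls → 2 ≤ length ls →
                count (pendent (spider ls)) (vertices (spider ls)) ≡ length ls
count-pendent ls legs≥1 k≥2 = begin
  count (pendent (spider ls)) (upTo (suc (sum ls)))
    ≡⟨ count-cong (upTo (suc (sum ls))) (pendent-pos ls legs≥1 k≥2 ∘ ∈-upTo⁻) ⟩
  count (isLeaf ls ∘ pos ls) (0 ∷ applyUpTo suc (sum ls))
    ≡⟨ cong (count (isLeaf ls ∘ pos ls)) (sym (map-applyUpTo id suc (sum ls))) ⟩
  count (isLeaf ls ∘ pos ls) (map suc (upTo (sum ls)))
    ≡⟨ count-map (isLeaf ls ∘ pos ls) suc (upTo (sum ls)) ⟩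
  count (isLeaf ls ∘ locate ls) (upTo (sum ls))
    ≡⟨ count-leaves ls legs≥1 ⟩
  length ls ∎
  where
  open ≡-Reasoning

closer-to-child⇒sameLeg : ∀ {k} (S : Pos k) i e → spiderDist S (at i e) < spiderDist S (parent i e) →
                          ∃[ d ] S ≡ at i d
closer-to-child⇒sameLeg centre   i e child<parent =
  contradiction child<parent (≡1+⇒≮ (spiderDist-centre-at i e))
closer-to-child⇒sameLeg (at j d) i e child<parent = fromLeg child<parent (j Fin.≟ i)
  where
  fromLeg : ∀ {j} → spiderDist (at j d) (at i e) < spiderDist (at j d) (parent i e) → Dec (j ≡ i) →
            ∃[ d′ ] at j d ≡ at i d′
  fromLeg child<parent (no j≢i) =
    contradiction child<parent (≡1+⇒≮ (spiderDist-otherLeg-at d e j≢i))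
  fromLeg _ (yes refl) = d , refl

module _ (ls : List ℕ) (legs≥1 : All (1 ≤_) ls) (k≥2 : 2 ≤ length ls) where

  private
    G = spider ls

  dist-vertex : ∀ {w R} → w < suc (sum ls) → Valid ls R → dist G w (vertex ls R) ≡ spiderDist (pos ls w) R
  dist-vertex {w} w<n vR =
    trans (dist-spider ls w<n (vertex<order ls vR)) (cong (spiderDist (pos ls w)) (pos-vertex ls vR))

  ℓ-spider : ∀ {R R′} → Valid ls R → Valid ls R′ →
             ℓ G (vertex ls R) (vertex ls R′) ≡
             count (λ w → isLeaf ls (pos ls w) ∧ (spiderDist (pos ls w) R <ᵇ spiderDist (pos ls w) R′))
                   (vertices G)
  ℓ-spider vR vR′ = count-cong (vertices G) λ {w} w∈ → let w<n = ∈-upTo⁻ w∈ in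
    cong₂ _∧_ (pendent-pos ls legs≥1 k≥2 w<n) (cong₂ _<ᵇ_ (dist-vertex w<n vR) (dist-vertex w<n vR′))

  ℓ-child≡1 : ∀ {i e} → e < lookup ls i → ℓ G (vertex ls (at i e)) (vertex ls (parent i e)) ≡ 1
  ℓ-child≡1 {i} {e} e<L =
    trans (ℓ-spider e<L vParent)
          (count-≡1 {closerLeaf ∘ pos ls} (upTo⁺ _) (∈-upTo⁺ (vertex<order ls vLast)) lastCloser onlyLast)
    where
    vParent = proj₁ (Edge-valid (edge e<L))
    closerLeaf : Pos (length ls) → Bool
    closerLeaf S = isLeaf ls S ∧ (spiderDist S (at i e) <ᵇ spiderDist S (parent i e))
    last = pred (lookup ls i)
    1+last≡L : suc last ≡ lookup ls i
    1+last≡L = suc-pred (lookup ls i) ⦃ >-nonZero (≤-<-trans z≤n e<L) ⦄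
    vLast : last < lookup ls i
    vLast = subst (last <_) 1+last≡L (n<1+n last)
    lastCloser : T (closerLeaf (pos ls (vertex ls (at i last))))
    lastCloser rewrite pos-vertex ls vLast = Equivalence.from T-∧
      (≡⇒≡ᵇ _ _ 1+last≡L ,
       <⇒<ᵇ (≤-reflexive (sym (spiderDist-below-parent i (s≤s⁻¹ (subst (e <_) (sym 1+last≡L) e<L))))))
    onlyLast : ∀ {x} → x ∈ upTo (suc (sum ls)) → T (closerLeaf (pos ls x)) → x ≡ vertex ls (at i last)
    onlyLast {x} x∈ leaf∧closer with Equivalence.to T-∧ leaf∧closer
    ... | leaf , closer with closer-to-child⇒sameLeg (pos ls x) i e (<ᵇ⇒< _ _ closer)
    ... | d , x↦d = begin
      x                     ≡⟨ proj₂ (vertex-pos ls (∈-upTo⁻ x∈)) ⟨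
      vertex ls (pos ls x)  ≡⟨ cong (vertex ls) x↦d ⟩
      vertex ls (at i d)    ≡⟨ cong (vertex ls ∘ at i) d≡last ⟩
      vertex ls (at i last) ∎
      where
      open ≡-Reasoning
      d≡last : d ≡ last
      d≡last = suc-injective (trans (≡ᵇ⇒≡ _ _ (subst (T ∘ isLeaf ls) x↦d leaf)) (sym 1+last≡L))

  ∣ℓ-ℓ∣-edge : ∀ {P Q} → Edge ls P Q →
               ∣ ℓ G (vertex ls P) (vertex ls Q) - ℓ G (vertex ls Q) (vertex ls P) ∣ ≡ length ls ∸ 2
  ∣ℓ-ℓ∣-edge {P} {Q} (edge {i} {e} e<L) rewrite ℓ-child≡1 e<L = ∣m-1∣≡n∸2 ℓ-sum k≥2
    where
    vP = proj₁ (Edge-valid (edge e<L))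
    noTie : ∀ {w} → w < suc (sum ls) → dist G w (vertex ls P) ≢ dist G w (vertex ls Q)
    noTie {w} w<n rewrite dist-vertex w<n vP | dist-vertex w<n e<L with spiderDist-edge (pos ls w) i e
    ... | inj₁ Q≡1+P = 1+n≢n ∘ trans (sym Q≡1+P) ∘ sym
    ... | inj₂ P≡1+Q = 1+n≢n ∘ trans (sym P≡1+Q)
    ℓ-sum : ℓ G (vertex ls P) (vertex ls Q) + 1 ≡ length ls
    ℓ-sum = begin
      ℓ G (vertex ls P) (vertex ls Q) + 1
        ≡⟨ cong (ℓ G (vertex ls P) (vertex ls Q) +_) (ℓ-child≡1 e<L) ⟨
      ℓ G (vertex ls P) (vertex ls Q) + ℓ G (vertex ls Q) (vertex ls P)
        ≡⟨ ℓ-+-ℓ G (vertex ls P) (vertex ls Q) noTie ⟩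
      count (pendent G) (vertices G)
        ≡⟨ count-pendent ls legs≥1 k≥2 ⟩
      length ls ∎
      where open ≡-Reasoning

mainTheorem6 : (legs : List ℕ) → All (λ L → 1 ≤ L) legs → 2 ≤ length legs →
    MoT (spider legs) ≡ (length legs ∸ 2) * (order (spider legs) ∸ 1)
mainTheorem6 ls legs≥1 k≥2 = begin
  MoT (spider ls)                                ≡⟨ MoT-const (spider ls) (length ls ∸ 2) edgeTerm ⟩
  length (spiderEdges 1 ls) * (length ls ∸ 2)  ≡⟨ cong (_* (length ls ∸ 2)) (length-spiderEdges 1 ls) ⟩
  sum ls * (length ls ∸ 2)                      ≡⟨ *-comm (sum ls) _ ⟩
  (length ls ∸ 2) * sum ls                      ∎
  where
  open ≡-Reasoning
  edgeTerm : ∀ {u v} → (u , v) ∈ spiderEdges 1 ls →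
             ∣ ℓ (spider ls) u v - ℓ (spider ls) v u ∣ ≡ length ls ∸ 2
  edgeTerm uv∈ with ∈-spiderEdges⁻ 1 ls uv∈
  ... | _ , _ , P→Q , refl , refl = ∣ℓ-ℓ∣-edge ls legs≥1 k≥2 P→Q
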